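{- Let $G=(V,E)$ be a finite simple graph with adjacency matrix $A_G$. If $G$ contains an induced cycle of length at least 4, or an induced claw $K_{1,3}$, or an asteroidal triple, then $A_G$ has a weighted asteroidal triple (which can be found).
   Context: $A_G$ is the $V\times V$ symmetric $0/1$ matrix with $(A_G)_{uv}=1$ iff $\{u,v\}\in E$ for $u\ne v$. For a symmetric matrix $A$ indexed by $V$ and $z\in V$, a path avoiding $z$ in $A$ is a sequence $(v_0,\dots,v_m)$ ($m\ge0$) of distinct elements of $V\setminus\{z\}$ with $A_{v_{i-1}v_i}>\min\{A_{v_{i-1}z},A_{v_iz}\}$ for $1\le i\le m$; $x\overset{z}{\sim}y$ means such a path from $x$ to $y$ exists. A weighted asteroidal triple of $A$ is a set $\{x,y,z\}$ of three distinct elements with $x\overset{z}{\sim}y$, $y\overset{x}{\sim}z$, $z\overset{y}{\sim}x$. An asteroidal triple of $G$ is an independent set $\{x,y,z\}$ of three vertices such that between any two of them there is a path in $G$ none of whose vertices is adjacent to the third. -}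

module Defs where

open import Data.Nat using (ℕ; zero; suc; _+_; _<_; _≤_; _⊔_; _⊓_)
open import Data.Nat.DivMod using (_%_)
open import Data.Fin using (Fin; toℕ; _≟_)
open import Data.Bool using (Bool; true; false; if_then_else_)
open import Data.List using (List; []; _∷_)
open import Data.List.Relation.Unary.All using (All)
open import Data.List.Relation.Unary.AllPairs using (AllPairs)
open import Data.Sum using (_⊎_)
open import Data.Product using (Σ; ∃; _×_; _,_)
open import Relation.Nullary using (¬_; does)
open import Relation.Binary.PropositionalEquality using (_≡_; _≢_)
open import Function.Bundles using (_⇔_)
open import Function.Definitions using (Injective)

record SimpleGraph (n : ℕ) : Set where
  field
    adj    : Fin n → Fin n → Bool
    sym    : ∀ u v → adj u v ≡ adj v u
    irrefl : ∀ v → adj v v ≡ false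

open SimpleGraph public

Adj : ∀ {n} → SimpleGraph n → Fin n → Fin n → Set
Adj G u v = adj G u v ≡ true

adjMatrix : ∀ {n} → SimpleGraph n → Fin n → Fin n → ℕ
adjMatrix G u v = if does (u ≟ v) then 0 else (if adj G u v then 1 else 0)

-- Sequences (v₀ ∷ vs) read as v₀, v₁, …, v_m

endpoint : ∀ {n} → Fin n → List (Fin n) → Fin n
endpoint x []       = x
endpoint x (v ∷ vs) = endpoint v vs

data Consecutive {n} (R : Fin n → Fin n → Set) : Fin n → List (Fin n) → Set where
  [_]  : ∀ x → Consecutive R x []
  _∷_  : ∀ {x v vs} → R x v → Consecutive R v vs → Consecutive R x (v ∷ vs)

Distinct : ∀ {n} → List (Fin n) → Set
Distinct = AllPairs (λ a b → a ≢ b)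

record PathAvoiding {n} (A : Fin n → Fin n → ℕ) (z x y : Fin n) : Set where
  field
    rest     : List (Fin n)
    ends     : endpoint x rest ≡ y
    distinct : Distinct (x ∷ rest)
    avoids   : All (λ v → v ≢ z) (x ∷ rest)
    steps    : Consecutive (λ u v → (A u z ⊓ A v z) < A u v) x rest

WeightedAT : ∀ {n} → (Fin n → Fin n → ℕ) → Fin n → Fin n → Fin n → Set
WeightedAT A x y z =
  x ≢ y × y ≢ z × x ≢ z ×
  PathAvoiding A z x y × PathAvoiding A x y z × PathAvoiding A y z x

HasWeightedAT : ∀ {n} → (Fin n → Fin n → ℕ) → Set
HasWeightedAT {n} A = Σ (Fin n) λ x → Σ (Fin n) λ y → Σ (Fin n) λ z → WeightedAT A x y z

CycNeighbour : ∀ {k} → Fin k → Fin k → Set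
CycNeighbour {zero}  ()
CycNeighbour {suc k} i j = toℕ j ≡ (toℕ i + 1) % suc k ⊎ toℕ i ≡ (toℕ j + 1) % suc k

record InducedCycle {n} (G : SimpleGraph n) : Set where
  field
    len   : ℕ
    len≥4 : 4 ≤ len
    vtx   : Fin len → Fin n
    inj   : Injective _≡_ _≡_ vtx
    edges : ∀ i j → Adj G (vtx i) (vtx j) ⇔ CycNeighbour i j

InducedClaw : ∀ {n} → SimpleGraph n → Set
InducedClaw {n} G = Σ (Fin n) λ c → Σ (Fin n) λ a₁ → Σ (Fin n) λ a₂ → Σ (Fin n) λ a₃ →
  Distinct (c ∷ a₁ ∷ a₂ ∷ a₃ ∷ []) ×
  Adj G c a₁ × Adj G c a₂ × Adj G c a₃ ×
  ¬ Adj G a₁ a₂ × ¬ Adj G a₁ a₃ × ¬ Adj G a₂ a₃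

record PathMissing {n} (G : SimpleGraph n) (z x y : Fin n) : Set where
  field
    rest     : List (Fin n)
    ends     : endpoint x rest ≡ y
    distinct : Distinct (x ∷ rest)
    missing  : All (λ v → ¬ Adj G v z) (x ∷ rest)
    steps    : Consecutive (Adj G) x rest

AsteroidalTriple : ∀ {n} → SimpleGraph n → Fin n → Fin n → Fin n → Set
AsteroidalTriple G x y z =
  x ≢ y × y ≢ z × x ≢ z ×
  ¬ Adj G x y × ¬ Adj G y z × ¬ Adj G x z ×
  PathMissing G z x y × PathMissing G x y z × PathMissing G y z x

HasAT : ∀ {n} → SimpleGraph n → Set
HasAT {n} G = Σ (Fin n) λ x → Σ (Fin n) λ y → Σ (Fin n) λ z → AsteroidalTriple G x y z

-- In A_G every entry is 0 or 1, so an edge uv of G is an admissible step of a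
-- path avoiding z as soon as one of u, v is NOT adjacent to z: then
-- min{A_uz, A_vz} = 0 < 1 = A_uv.  All three cases reduce to this observation.
--   * Asteroidal triple: every vertex of a path missing the third vertex z is
--     non-adjacent to z, so the path itself avoids z in A_G.
--   * Induced claw with leaves a₁ a₂ a₃ and centre c: the path aᵢ c aⱼ avoids
--     the third leaf, since both its edges have a leaf endpoint.
--   * Induced cycle v₀ … v_K (K ≥ 3): the triple v₀, v_{K-1}, v_K works, using
--     the long arc v₀ … v_{K-1} (avoiding v_K) and the single edges
--     v_{K-1} v_K and v_K v₀.
-- All proofs are constructive, so the triple is computed from the obstruction.
module Submission where

open import Defs
open import Data.Nat using (ℕ; zero; suc; _+_; _<_; _≤_; _⊓_; z≤n; s≤s)
open import Data.Nat.Properties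
  using (+-comm; ≤-trans; ≤-refl; n≤1+n; <⇒≤; m⊓n≤n; <-irrefl; suc-injective; 0≢1+n)
open import Data.Nat.DivMod using (_%_; n%n≡0; m<n⇒m%n≡m)
open import Data.Fin using (Fin; toℕ; _≟_) renaming (zero to fzero; suc to fsuc)
open import Data.Bool using (true; false)
open import Data.Empty using (⊥-elim)
open import Data.List using (List; []; _∷_)
open import Data.List.Relation.Unary.All using (All; []; _∷_)
open import Data.List.Relation.Unary.AllPairs using ([]; _∷_)
open import Data.Sum using (_⊎_; inj₁; inj₂)
open import Data.Product using (_,_)
open import Relation.Nullary using (¬_; yes; no)
open import Relation.Binary.PropositionalEquality
  using (_≡_; _≢_; refl; trans; cong; subst; subst₂) renaming (sym to ≡-sym)
open import Function.Bundles using (_⇔_; Equivalence)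
open import Function.Definitions using (Injective)

≢-sym : ∀ {n} {a b : Fin n} → a ≢ b → b ≢ a
≢-sym a≢b b≡a = a≢b (≡-sym b≡a)

consecutive-map : ∀ {n} {R S : Fin n → Fin n → Set} {P : Fin n → Set} {x vs} →
  (∀ {u v} → P u → R u v → S u v) →
  All P (x ∷ vs) → Consecutive R x vs → Consecutive S x vs
consecutive-map f _          [ x ]     = [ x ]
consecutive-map f (px ∷ pvs) (r ∷ rs) = f px r ∷ consecutive-map f pvs rs

-- The sequence f 1, …, f m, i.e. the tail of the path f 0, f 1, …, f m.
trace : ∀ {n} → (ℕ → Fin n) → ℕ → List (Fin n)
trace f zero    = []
trace f (suc m) = f 1 ∷ trace (λ i → f (suc i)) m

trace-endpoint : ∀ {n} (f : ℕ → Fin n) m → endpoint (f 0) (trace f m) ≡ f m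
trace-endpoint f zero    = refl
trace-endpoint f (suc m) = trace-endpoint (λ i → f (suc i)) m

trace-all : ∀ {n} {P : Fin n → Set} (f : ℕ → Fin n) m →
  (∀ i → i ≤ m → P (f i)) → All P (f 0 ∷ trace f m)
trace-all f zero    h = h 0 z≤n ∷ []
trace-all f (suc m) h = h 0 z≤n ∷ trace-all (λ i → f (suc i)) m (λ i i≤m → h (suc i) (s≤s i≤m))

trace-consecutive : ∀ {n} {R : Fin n → Fin n → Set} (f : ℕ → Fin n) m →
  (∀ i → i < m → R (f i) (f (suc i))) → Consecutive R (f 0) (trace f m)
trace-consecutive f zero    h = [ f 0 ]
trace-consecutive f (suc m) h =
  h 0 (s≤s z≤n) ∷ trace-consecutive (λ i → f (suc i)) m (λ i i<m → h (suc i) (s≤s i<m))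

trace-distinct : ∀ {n} (f : ℕ → Fin n) m →
  (∀ a b → a ≤ m → b ≤ m → f a ≡ f b → a ≡ b) → Distinct (f 0 ∷ trace f m)
trace-distinct f zero    inj = [] ∷ []
trace-distinct f (suc m) inj =
  trace-all (λ i → f (suc i)) m (λ i i≤m eq → 0≢1+n (inj 0 (suc i) z≤n (s≤s i≤m) eq))
  ∷ trace-distinct (λ i → f (suc i)) m
      (λ a b a≤m b≤m eq → suc-injective (inj (suc a) (suc b) (s≤s a≤m) (s≤s b≤m) eq))

pathAlong : ∀ {n} (A : Fin n → Fin n → ℕ) (z : Fin n) (f : ℕ → Fin n) m →
  (∀ a b → a ≤ m → b ≤ m → f a ≡ f b → a ≡ b) →
  (∀ i → i ≤ m → f i ≢ z) →
  (∀ i → i < m → (A (f i) z ⊓ A (f (suc i)) z) < A (f i) (f (suc i))) →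
  PathAvoiding A z (f 0) (f m)
pathAlong A z f m inj avoid step = record
  { rest     = trace f m
  ; ends     = trace-endpoint f m
  ; distinct = trace-distinct f m inj
  ; avoids   = trace-all f m avoid
  ; steps    = trace-consecutive f m step
  }

module _ {n} (G : SimpleGraph n) where

  adj-sym : ∀ {u v} → Adj G u v → Adj G v u
  adj-sym {u} {v} uv = trans (SimpleGraph.sym G v u) uv

  nonAdj-sym : ∀ {u v} → ¬ Adj G u v → ¬ Adj G v u
  nonAdj-sym ¬uv vu = ¬uv (adj-sym vu)

  adjMatrix-edge : ∀ {u v} → Adj G u v → adjMatrix G u v ≡ 1
  adjMatrix-edge {u} {v} uv with u ≟ v
  ... | yes refl = ⊥-elim (false≢true (trans (≡-sym (irrefl G u)) uv))
    where
      false≢true : false ≢ true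
      false≢true ()
  ... | no _ rewrite uv = refl

  adjMatrix-nonEdge : ∀ {u v} → ¬ Adj G u v → adjMatrix G u v ≡ 0
  adjMatrix-nonEdge {u} {v} ¬uv with u ≟ v
  ... | yes _ = refl
  ... | no _ with adj G u v
  ...   | true  = ⊥-elim (¬uv refl)
  ...   | false = refl

  edge-step : ∀ {z u v} → Adj G u v → (¬ Adj G u z ⊎ ¬ Adj G v z) →
    (adjMatrix G u z ⊓ adjMatrix G v z) < adjMatrix G u v
  edge-step uv (inj₁ ¬uz) rewrite adjMatrix-edge uv | adjMatrix-nonEdge ¬uz = s≤s z≤n
  edge-step {z} {u} uv (inj₂ ¬vz) rewrite adjMatrix-edge uv | adjMatrix-nonEdge ¬vz =
    s≤s (m⊓n≤n (adjMatrix G u z) 0)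

  twoEdgePath : ∀ {p c q r} → p ≢ c → p ≢ q → c ≢ q → p ≢ r → c ≢ r → q ≢ r →
    Adj G p c → Adj G c q → ¬ Adj G p r → ¬ Adj G q r →
    PathAvoiding (adjMatrix G) r p q
  twoEdgePath {q = q} p≢c p≢q c≢q p≢r c≢r q≢r pc cq ¬pr ¬qr = record
    { rest     = _ ∷ q ∷ []
    ; ends     = refl
    ; distinct = (p≢c ∷ p≢q ∷ []) ∷ (c≢q ∷ []) ∷ [] ∷ []
    ; avoids   = p≢r ∷ c≢r ∷ q≢r ∷ []
    ; steps    = edge-step pc (inj₁ ¬pr) ∷ edge-step cq (inj₂ ¬qr) ∷ [ q ]
    }

  edgePath : ∀ {u v r} → u ≢ v → u ≢ r → v ≢ r →
    Adj G u v → (¬ Adj G u r ⊎ ¬ Adj G v r) → PathAvoiding (adjMatrix G) r u v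
  edgePath {v = v} u≢v u≢r v≢r uv ¬r = record
    { rest     = v ∷ []
    ; ends     = refl
    ; distinct = (u≢v ∷ []) ∷ [] ∷ []
    ; avoids   = u≢r ∷ v≢r ∷ []
    ; steps    = edge-step uv ¬r ∷ [ v ]
    }

  -- Every vertex after the first of a graph path missing N(z) differs from
  -- z, because it is adjacent to its predecessor, which is not adjacent to z.
  successors-avoid : ∀ {z x vs} → Consecutive (Adj G) x vs →
    All (λ v → ¬ Adj G v z) (x ∷ vs) → All (λ v → v ≢ z) vs
  successors-avoid [ x ]     _            = []
  successors-avoid (xv ∷ vs) (¬xz ∷ ¬vsz) =
    (λ v≡z → ¬xz (subst (Adj G _) v≡z xv)) ∷ successors-avoid vs ¬vsz

  pathMissing⇒pathAvoiding : ∀ {z x y} → x ≢ z → PathMissing G z x y →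
    PathAvoiding (adjMatrix G) z x y
  pathMissing⇒pathAvoiding x≢z p = record
    { rest     = rest
    ; ends     = ends
    ; distinct = distinct
    ; avoids   = x≢z ∷ successors-avoid steps missing
    ; steps    = consecutive-map (λ ¬uz uv → edge-step uv (inj₁ ¬uz)) missing steps
    }
    where open PathMissing p

  asteroidal⇒weightedAT : HasAT G → HasWeightedAT (adjMatrix G)
  asteroidal⇒weightedAT (x , y , z , x≢y , y≢z , x≢z , _ , _ , _ , pxy , pyz , pzx) =
    x , y , z , x≢y , y≢z , x≢z ,
    pathMissing⇒pathAvoiding x≢z pxy ,
    pathMissing⇒pathAvoiding (≢-sym x≢y) pyz ,
    pathMissing⇒pathAvoiding (≢-sym y≢z) pzx

  claw⇒weightedAT : InducedClaw G → HasWeightedAT (adjMatrix G)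
  claw⇒weightedAT
    (c , a₁ , a₂ , a₃ ,
     ((c≢a₁ ∷ c≢a₂ ∷ c≢a₃ ∷ []) ∷ (a₁≢a₂ ∷ a₁≢a₃ ∷ []) ∷ (a₂≢a₃ ∷ []) ∷ [] ∷ []) ,
     ca₁ , ca₂ , ca₃ , ¬a₁a₂ , ¬a₁a₃ , ¬a₂a₃) =
    a₁ , a₂ , a₃ , a₁≢a₂ , a₂≢a₃ , a₁≢a₃ ,
    twoEdgePath (≢-sym c≢a₁) a₁≢a₂ c≢a₂ a₁≢a₃ c≢a₃ a₂≢a₃
      (adj-sym ca₁) ca₂ ¬a₁a₃ ¬a₂a₃ ,
    twoEdgePath (≢-sym c≢a₂) a₂≢a₃ c≢a₃ (≢-sym a₁≢a₂) c≢a₁ (≢-sym a₁≢a₃)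
      (adj-sym ca₂) ca₃ (nonAdj-sym ¬a₁a₂) (nonAdj-sym ¬a₁a₃) ,
    twoEdgePath (≢-sym c≢a₃) (≢-sym a₁≢a₃) c≢a₁ (≢-sym a₂≢a₃) c≢a₂ a₁≢a₂
      (adj-sym ca₃) ca₁ (nonAdj-sym ¬a₂a₃) ¬a₁a₂

-- Induced cycles.  The vertices are indexed by ℕ (through 'clamp') so that
-- arcs of the cycle can be built with 'pathAlong'.

-- The index i read in Fin (suc K), saturating at K; exact for i ≤ K.
clamp : (K : ℕ) → ℕ → Fin (suc K)
clamp K       zero    = fzero
clamp zero    (suc i) = fzero
clamp (suc K) (suc i) = fsuc (clamp K i)

toℕ-clamp : ∀ K i → i ≤ K → toℕ (clamp K i) ≡ i
toℕ-clamp K       zero    _         = refl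
toℕ-clamp (suc K) (suc i) (s≤s i≤K) = cong suc (toℕ-clamp K i i≤K)

-- A cycle of length K + 1 = j + 4 with vertices v 0, …, v K.
module InducedCycleCase {n} (G : SimpleGraph n) (j : ℕ)
    (vtx : Fin (suc (suc (suc (suc j)))) → Fin n)
    (inj : Injective _≡_ _≡_ vtx)
    (edges : ∀ a b → Adj G (vtx a) (vtx b) ⇔ CycNeighbour a b) where

  K : ℕ
  K = suc (suc (suc j))

  P : ℕ
  P = suc (suc j)

  ≤P⇒≤K : ∀ {i} → i ≤ P → i ≤ K
  ≤P⇒≤K i≤P = ≤-trans i≤P (n≤1+n P)

  <P⇒<K : ∀ {i} → i < P → i < K
  <P⇒<K = ≤P⇒≤K

  v : ℕ → Fin n
  v i = vtx (clamp K i)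

  v-injective : ∀ a b → a ≤ K → b ≤ K → v a ≡ v b → a ≡ b
  v-injective a b a≤K b≤K eq =
    trans (≡-sym (toℕ-clamp K a a≤K)) (trans (cong toℕ (inj eq)) (toℕ-clamp K b b≤K))

  v-distinct : ∀ a b → a ≤ K → b ≤ K → a ≢ b → v a ≢ v b
  v-distinct a b a≤K b≤K a≢b eq = a≢b (v-injective a b a≤K b≤K eq)

  succ-mod : ∀ a → a < K → (a + 1) % suc K ≡ suc a
  succ-mod a a<K = trans (cong (_% suc K) (+-comm a 1)) (m<n⇒m%n≡m (s≤s a<K))

  succ-mod-last : (K + 1) % suc K ≡ 0
  succ-mod-last = trans (cong (_% suc K) (+-comm K 1)) (n%n≡0 (suc K))

  Neighbour : ℕ → ℕ → Set
  Neighbour a b = b ≡ (a + 1) % suc K ⊎ a ≡ (b + 1) % suc K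

  cycle-adj : ∀ a b → a ≤ K → b ≤ K → Adj G (v a) (v b) ⇔ Neighbour a b
  cycle-adj a b a≤K b≤K =
    subst₂ (λ x y → Adj G (v a) (v b) ⇔ Neighbour x y)
      (toℕ-clamp K a a≤K) (toℕ-clamp K b b≤K) (edges (clamp K a) (clamp K b))

  arc-edge : ∀ i → i < K → Adj G (v i) (v (suc i))
  arc-edge i i<K =
    Equivalence.from (cycle-adj i (suc i) (≤-trans (n≤1+n i) i<K) i<K)
      (inj₁ (≡-sym (succ-mod i i<K)))

  closing-edge : Adj G (v K) (v 0)
  closing-edge = Equivalence.from (cycle-adj K 0 ≤-refl z≤n) (inj₁ (≡-sym succ-mod-last))

  inner-nonAdj-last : ∀ i → 1 ≤ i → i < P → ¬ Adj G (v i) (v K)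
  inner-nonAdj-last i 0<i i<P ivK
    with Equivalence.to (cycle-adj i K (<⇒≤ (<P⇒<K i<P)) ≤-refl) ivK
  ... | inj₁ K≡i+1 = <-irrefl (≡-sym (trans K≡i+1 (succ-mod i (<P⇒<K i<P)))) (s≤s i<P)
  ... | inj₂ i≡K+1 = <-irrefl (≡-sym (trans i≡K+1 succ-mod-last)) 0<i

  penultimate-nonAdj-first : ¬ Adj G (v P) (v 0)
  penultimate-nonAdj-first P0 with Equivalence.to (cycle-adj P 0 (≤P⇒≤K ≤-refl) z≤n) P0
  ... | inj₁ 0≡P+1 = 0≢1+n (trans 0≡P+1 (succ-mod P ≤-refl))
  ... | inj₂ P≡1   = P≢1 (trans P≡1 (succ-mod 0 (s≤s z≤n)))
    where
      P≢1 : P ≢ 1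
      P≢1 ()

  -- The arc v 0, …, v P avoids v K: each of its edges has an inner endpoint.
  arc : PathAvoiding (adjMatrix G) (v K) (v 0) (v P)
  arc = pathAlong (adjMatrix G) (v K) v P
    (λ a b a≤P b≤P → v-injective a b (≤P⇒≤K a≤P) (≤P⇒≤K b≤P))
    (λ i i≤P → v-distinct i K (≤P⇒≤K i≤P) ≤-refl (λ { refl → <-irrefl refl i≤P }))
    arc-step
    where
      arc-step : ∀ i → i < P →
        (adjMatrix G (v i) (v K) ⊓ adjMatrix G (v (suc i)) (v K)) < adjMatrix G (v i) (v (suc i))
      arc-step zero    _ =
        edge-step G (arc-edge 0 (s≤s z≤n)) (inj₂ (inner-nonAdj-last 1 ≤-refl (s≤s (s≤s z≤n))))
      arc-step (suc i) i+1<P =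
        edge-step G (arc-edge (suc i) (<P⇒<K i+1<P))
          (inj₁ (inner-nonAdj-last (suc i) (s≤s z≤n) i+1<P))

  first≢penultimate : v 0 ≢ v P
  first≢penultimate = v-distinct 0 P z≤n (≤P⇒≤K ≤-refl) (λ ())

  penultimate≢last : v P ≢ v K
  penultimate≢last = v-distinct P K (≤P⇒≤K ≤-refl) ≤-refl (λ ())

  first≢last : v 0 ≢ v K
  first≢last = v-distinct 0 K z≤n ≤-refl (λ ())

  -- v 0, v P, v K is a weighted asteroidal triple: the arc, and the
  -- single edges v P v K and v K v 0 whose endpoints v P, v 0 are non-adjacent.
  weightedAT : HasWeightedAT (adjMatrix G)
  weightedAT =
    v 0 , v P , v K , first≢penultimate , penultimate≢last , first≢last ,
    arc ,
    edgePath G penultimate≢last (≢-sym first≢penultimate) (≢-sym first≢last)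
      (arc-edge P ≤-refl) (inj₁ penultimate-nonAdj-first) ,
    edgePath G (≢-sym first≢last) (≢-sym penultimate≢last) first≢penultimate
      closing-edge (inj₂ (nonAdj-sym G penultimate-nonAdj-first))

cycle⇒weightedAT : ∀ {n} (G : SimpleGraph n) → InducedCycle G → HasWeightedAT (adjMatrix G)
cycle⇒weightedAT G record { len = suc (suc (suc (suc j))) ; len≥4 = s≤s (s≤s (s≤s (s≤s z≤n)))
                          ; vtx = vtx ; inj = inj ; edges = edges } =
  InducedCycleCase.weightedAT G j vtx inj edges

lemma4p2 : ∀ {n} (G : SimpleGraph n) →
    (InducedCycle G ⊎ InducedClaw G ⊎ HasAT G) →
    HasWeightedAT (adjMatrix G)
lemma4p2 G (inj₁ cycle)         = cycle⇒weightedAT G cycle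
lemma4p2 G (inj₂ (inj₁ claw))   = claw⇒weightedAT G claw
lemma4p2 G (inj₂ (inj₂ triple)) = asteroidal⇒weightedAT G triple
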